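{- For $0\le k\le n$, \[ S_B[n,k]=\sum_{j=k}^n\binom{n}{j}[2]_q^{\,j-k}q^{j-k}S[j,k]_{q^2} \quad\text{and}\quad S_B[n,k]=S_D[n,k]+n\,[2]_q^{\,n-k-1}q^{n-k-1}S[n-1,k]_{q^2}. \]
   Context: $[k]_q=1+q+\dots+q^{k-1}$, $[0]_q=0$. The type A $q$-Stirling numbers $S[n,k]$ satisfy $S[0,k]=\delta_{0k}$ and $S[n,k]=S[n-1,k-1]+[k]_qS[n-1,k]$; $S[n,k]_{q^2}$ is $S[n,k]$ with $q$ replaced by $q^2$. $S_B[n,k]$ satisfies $S_B[0,k]=\delta_{0k}$ and $S_B[n,k]=S_B[n-1,k-1]+[2k+1]_qS_B[n-1,k]$. For $S\subset\mathbb{Z}\setminus\{0\}$ let $\overline{S}=\{ -i:i\in S\}$. A standard signed partition (SSP) of $S$ with $k$ blocks is a sequence $(S_1,\dots,S_k)$ of pairwise disjoint nonempty subsets of $S\cup\overline{S}$ with $\{S_1,\dots,S_k,\overline{S_1},\dots,\overline{S_k}\}$ a partition of $S\cup\overline{S}$ and $\min|S_1|\le\dots\le\min|S_k|$, where $|S_i|=\{|j|:j\in S_i\}$. A PSSP of $S$ is an SSP of a subset of $S$. $B(S,k)$, $B_{\subseteq}(S,k)$ denote the sets of SSPs, resp. PSSPs, of $S$ with $k$ blocks, and $D_{\subseteq}([n],k)=B_{\subseteq}([n],k)\setminus\bigcup_{i=1}^nB([n]\setminus\{i\},k)$. For $\pi=(S_1,\dots,S_k)$, $\mathrm{pos}(\pi)=\#\{x\in\bigcup_iS_i:x>0\}$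 and $m(\pi)=2\sum_{i=1}^k i\,\#S_i-\mathrm{pos}(\pi)$. The type D $q$-Stirling numbers are $S_D[n,k]=\frac{1}{q^{k^2}[2]_q^k}\sum_{\pi\in D_{\subseteq}([n],k)}q^{m(\pi)}$. -}

module Defs where

open import Level using (Level)
open import Algebra.Bundles using (CommutativeRing; Semiring)
open import Data.Nat as ℕ using (ℕ; zero; suc; _∸_)
open import Data.Nat.Combinatorics using (_C_)
open import Data.Bool using (Bool; true; false; _∧_; _∨_; not; if_then_else_)
open import Data.Maybe using (Maybe; just; nothing)
open import Data.Fin as Fin using (Fin)
open import Data.Product using (_×_; _,_)
open import Data.Vec as Vec using (Vec; []; _∷_)
open import Data.List as List using (List; []; _∷_)
open import Data.Nat.ListAction renaming (sum to sumℕ)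

-- A PSSP π = (S_1,…,S_k) of [n] is encoded by a vector
--   a : Vec (Maybe (Fin k × Bool)) n
-- where the entry at position i (representing the integer i+1) is
--   nothing          if i+1 ∉ S_1 ∪ … ∪ S_k ∪ S̄_1 ∪ … ∪ S̄_k (not in the support),
--   just (b , true)   if  (i+1) ∈ S_(b+1)  (hence -(i+1) ∈ S̄_(b+1)),
--   just (b , false)  if -(i+1) ∈ S_(b+1)  (hence  (i+1) ∈ S̄_(b+1)).
-- This is exactly the data of pairwise disjoint S_j with
-- {S_j, S̄_j} forming a partition of S ∪ S̄ (S = support).

Assign : ℕ → ℕ → Set
Assign n k = Vec (Maybe (Fin k × Bool)) n

entries : (k : ℕ) → List (Maybe (Fin k × Bool))
entries k = nothing ∷ List.map just (List.cartesianProduct (List.allFin k) (true ∷ false ∷ []))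

allAssign : (n k : ℕ) → List (Assign n k)
allAssign zero    k = [] ∷ []
allAssign (suc n) k =
  List.concatMap (λ e → List.map (e ∷_) (allAssign n k)) (entries k)

inBlock : ∀ {k} → Fin k → Maybe (Fin k × Bool) → Bool
inBlock b nothing        = false
inBlock b (just (c , _)) = Fin.toℕ b ℕ.≡ᵇ Fin.toℕ c

isPos : ∀ {k} → Maybe (Fin k × Bool) → Bool
isPos nothing        = false
isPos (just (_ , s)) = s

count : ∀ {A : Set} {n} → (A → Bool) → Vec A n → ℕ
count p []       = 0
count p (x ∷ xs) = (if p x then 1 else 0) ℕ.+ count p xs

-- min |S_(b+1)|, i.e. smallest integer j ∈ [n] with ±j ∈ S_(b+1);
-- `nothing` if the block is empty.  (offset = integer represented by the head)
blockMinFrom : ∀ {n k} → ℕ → Fin k → Assign n k → Maybe ℕ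
blockMinFrom j b []       = nothing
blockMinFrom j b (e ∷ es) = if inBlock b e then just j else blockMinFrom (suc j) b es

blockMin : ∀ {n k} → Fin k → Assign n k → Maybe ℕ
blockMin = blockMinFrom 1

blockMins : ∀ {n k} → Assign n k → List (Maybe ℕ)
blockMins {k = k} a = List.map (λ b → blockMin b a) (List.allFin k)

nondecreasing : List (Maybe ℕ) → Bool
nondecreasing []                          = true
nondecreasing (nothing ∷ _)               = false
nondecreasing (just x ∷ [])               = true
nondecreasing (just x ∷ nothing ∷ _)      = false
nondecreasing (just x ∷ just y ∷ rest)    = (x ℕ.≤ᵇ y) ∧ nondecreasing (just y ∷ rest)

isPSSP : ∀ {n k} → Assign n k → Bool
isPSSP a = nondecreasing (blockMins a)

isNothing : ∀ {A : Set} → Maybe A → Bool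
isNothing nothing  = true
isNothing (just _) = false

supportIsAllBut : ∀ {n k} → Fin n → Assign n k → Bool
supportIsAllBut {suc n} Fin.zero    (e ∷ es) = isNothing e ∧ Vec.foldr _ (λ x r → not (isNothing x) ∧ r) true es
supportIsAllBut {suc n} (Fin.suc i) (e ∷ es) = not (isNothing e) ∧ supportIsAllBut i es

-- a ∈ ⋃_{i=1}^n B([n] ∖ {i}, k)  (given that a is a PSSP)
inSomeAllBut : ∀ {n k} → Assign n k → Bool
inSomeAllBut {n} a = List.foldr _∨_ false (List.map (λ i → supportIsAllBut i a) (List.allFin n))

isD : ∀ {n k} → Assign n k → Bool
isD a = isPSSP a ∧ not (inSomeAllBut a)

Dlist : (n k : ℕ) → List (Assign n k)
Dlist n k = List.filter (λ a → Data.Bool.T? (isD a)) (allAssign n k)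
  where import Data.Bool

blockSize : ∀ {n k} → Fin k → Assign n k → ℕ
blockSize b a = count (inBlock b) a

pos : ∀ {n k} → Assign n k → ℕ
pos a = count isPos a

mStat : ∀ {n k} → Assign n k → ℕ
mStat {k = k} a =
  2 ℕ.* sumℕ (List.map (λ b → suc (Fin.toℕ b) ℕ.* blockSize b a) (List.allFin k)) ∸ pos a

module QStirling {c ℓ : Level} (R : CommutativeRing c ℓ) where
  open CommutativeRing R
  open import Algebra.Definitions.RawSemiring (Semiring.rawSemiring semiring) public using (_^_) renaming (_×_ to _·ℕ_)

  qint : Carrier → ℕ → Carrier
  qint q zero    = 0#
  qint q (suc k) = 1# + q * qint q k

  S : Carrier → ℕ → ℕ → Carrier
  S q zero    zero    = 1#
  S q zero    (suc k) = 0#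
  S q (suc n) zero    = qint q 0 * S q n 0
  S q (suc n) (suc k) = S q n k + qint q (suc k) * S q n (suc k)

  SB : Carrier → ℕ → ℕ → Carrier
  SB q zero    zero    = 1#
  SB q zero    (suc k) = 0#
  SB q (suc n) zero    = qint q 1 * SB q n 0
  SB q (suc n) (suc k) = SB q n k + qint q (suc (2 ℕ.* suc k)) * SB q n (suc k)

  sumList : List Carrier → Carrier
  sumList = List.foldr _+_ 0#

  DSum : Carrier → ℕ → ℕ → Carrier
  DSum q n k = sumList (List.map (λ a → q ^ mStat a) (Dlist n k))

  -- the normalising factor q^{k²} [2]_q^k, so that
  -- S_D[n,k] = DSum q n k / DNorm q k
  DNorm : Carrier → ℕ → Carrier
  DNorm q k = (q ^ (k ℕ.* k)) * (qint q 2 ^ k)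

  SBsum : Carrier → ℕ → ℕ → Carrier
  SBsum q n k =
    sumList (List.map (λ j → (n C j) ·ℕ ((qint q 2 ^ (j ∸ k)) * (q ^ (j ∸ k)) * S (q * q) j k))
                      (List.map (k ℕ.+_) (List.upTo (suc (n ∸ k)))))

  SDcorr : Carrier → ℕ → ℕ → Carrier
  SDcorr q n k = n ·ℕ ((qint q 2 ^ (n ∸ k ∸ 1)) * (q ^ (n ∸ k ∸ 1)) * S (q * q) (n ∸ 1) k)

-- Both sides of the first identity satisfy the recursion defining S_B: writing
-- t_k(j) = [2]_q^(j-k) q^(j-k) S[j,k]_(q²), Pascal's rule turns the recursion
-- t_(k+1)(j+1) = t_k(j) + q [2]_q [k+1]_(q²) t_(k+1)(j) of S into the one of S_B, since
-- [2k+3]_q = 1 + q [2]_q [k+1]_(q²).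
--
-- For the second, a PSSP is a word recording for each i ∈ [n] the block and the sign of ±i (or
-- that i is unused). The PSSPs are exactly the restricted growth words, and m(π) adds up letter
-- weights 2b+1 or 2b+2 for a positive or negative entry in block b+1. Reading a word from the
-- left, the number of open blocks walks from 0 to k: a letter that opens no block has weight
-- [2j+1]_q at level j, one that opens block j+1 has weight q^(2j+1) [2]_q. Reading the same
-- paths from the right shows that they sum to q^(k²) [2]_q^k S_B[n,k]. The SSPs of [n]∖{i}
-- are, after deleting position i, the words of length n-1 with full support; their paths have
-- stay weight q [2j]_q and sum to q^(k²) [2]_q^k t_k(n-1). All other PSSPs form D_⊆([n],k).

module Submission where

open import Defs
open import Level using (Level)
open import Algebra.Bundles using (CommutativeMonoid; CommutativeRing)
open import Data.Bool using (Bool; true; false; _∧_; _∨_; not; if_then_else_; T?)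
open import Data.Bool.Properties using (T-≡; ¬-not; ∧-identityʳ; ∧-zeroʳ; ∨-identityʳ)
open import Data.Fin as Fin using (Fin; toℕ)
open import Data.Fin.Properties using (toℕ<n)
open import Data.List as List using (List; []; _∷_)
import Data.List.Properties as List
open import Data.List.Membership.Propositional using (_∈_)
open import Data.List.Relation.Unary.Any using (here; there)
open import Data.Maybe using (Maybe; just; nothing)
open import Data.Maybe.Relation.Unary.All as Maybe using (just; nothing) renaming (All to AllMaybe)
open import Data.Nat as ℕ using (ℕ; zero; suc; _∸_; _≡ᵇ_; _<ᵇ_; _≤ᵇ_; _≤_; _<_; z≤n; s≤s)
import Data.Nat.Properties as ℕ
open import Data.Nat.Combinatorics using (_C_; nCk≡nC[n∸k]; nCn≡1; k>n⇒nCk≡0; nCk+nC[k+1]≡[n+1]C[k+1])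
open import Data.Nat.ListAction using () renaming (sum to sumℕ)
open import Data.Product using (_×_; _,_)
open import Data.Sum using (inj₁; inj₂)
open import Data.Vec as Vec using (Vec; []; _∷_)
open import Function using (_∘_; Equivalence)
open import Relation.Binary.Definitions using (tri<; tri≈; tri>)
open import Relation.Binary.PropositionalEquality as ≡ using (_≡_; _≢_)
open import Relation.Nullary using (¬_; yes; no; contradiction)

module ListSum {a ℓ} (M : CommutativeMonoid a ℓ) where
  open CommutativeMonoid M renaming
    (_∙_ to _+_; ε to 0#; ∙-cong to +-cong; ∙-congˡ to +-congˡ; identityˡ to +-identityˡ; assoc to +-assoc)
  open import Algebra.Properties.CommutativeMonoid.Sum M using (sum; ∑-distrib-+)
  open import Algebra.Properties.CommutativeSemigroup commutativeSemigroup using (interchange)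

  ∑ₗ : ∀ {A : Set} → (A → Carrier) → List A → Carrier
  ∑ₗ f xs = List.foldr _+_ 0# (List.map f xs)

  private variable A B : Set

  ∑ₗ-cong : ∀ {f g : A → Carrier} xs → (∀ x → f x ≈ g x) → ∑ₗ f xs ≈ ∑ₗ g xs
  ∑ₗ-cong []       f≈g = refl
  ∑ₗ-cong (x ∷ xs) f≈g = +-cong (f≈g x) (∑ₗ-cong xs f≈g)

  ∑ₗ-zero : ∀ {f : A → Carrier} xs → (∀ x → f x ≈ 0#) → ∑ₗ f xs ≈ 0#
  ∑ₗ-zero []       f≈0 = refl
  ∑ₗ-zero (x ∷ xs) f≈0 = trans (+-cong (f≈0 x) (∑ₗ-zero xs f≈0)) (+-identityˡ 0#)

  ∑ₗ-distrib-+ : ∀ (f g : A → Carrier) xs → ∑ₗ (λ x → f x + g x) xs ≈ ∑ₗ f xs + ∑ₗ g xs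
  ∑ₗ-distrib-+ f g []       = sym (+-identityˡ 0#)
  ∑ₗ-distrib-+ f g (x ∷ xs) = trans (+-congˡ (∑ₗ-distrib-+ f g xs)) (interchange _ _ _ _)

  ∑ₗ-++ : ∀ (f : A → Carrier) xs ys → ∑ₗ f (xs List.++ ys) ≈ ∑ₗ f xs + ∑ₗ f ys
  ∑ₗ-++ f []       ys = sym (+-identityˡ _)
  ∑ₗ-++ f (x ∷ xs) ys = trans (+-congˡ (∑ₗ-++ f xs ys)) (sym (+-assoc _ _ _))

  ∑ₗ-concatMap : ∀ (f : B → Carrier) (h : A → List B) xs →
                 ∑ₗ f (List.concatMap h xs) ≈ ∑ₗ (λ x → ∑ₗ f (h x)) xs
  ∑ₗ-concatMap f h []       = refl
  ∑ₗ-concatMap f h (x ∷ xs) = trans (∑ₗ-++ f (h x) _) (+-congˡ (∑ₗ-concatMap f h xs))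

  ∑ₗ-comm : ∀ (f : A → B → Carrier) xs ys →
            ∑ₗ (λ x → ∑ₗ (f x) ys) xs ≈ ∑ₗ (λ y → ∑ₗ (λ x → f x y) xs) ys
  ∑ₗ-comm f []       ys = sym (∑ₗ-zero ys (λ _ → refl))
  ∑ₗ-comm f (x ∷ xs) ys = trans (+-congˡ (∑ₗ-comm f xs ys)) (sym (∑ₗ-distrib-+ (f x) _ ys))

  ∑ₗ-filter : ∀ (p : A → Bool) (f : A → Carrier) xs →
              List.foldr _+_ 0# (List.map f (List.filter (T? ∘ p) xs))
                ≈ ∑ₗ (λ x → if p x then f x else 0#) xs
  ∑ₗ-filter p f []       = refl
  ∑ₗ-filter p f (x ∷ xs) with p x
  ... | true  = +-congˡ (∑ₗ-filter p f xs)
  ... | false = trans (∑ₗ-filter p f xs) (sym (+-identityˡ _))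

  ∑ₗ-map : ∀ (f : B → Carrier) (g : A → B) xs → ∑ₗ f (List.map g xs) ≈ ∑ₗ (f ∘ g) xs
  ∑ₗ-map f g xs = reflexive (≡.cong (List.foldr _+_ 0#) (≡.sym (List.map-∘ xs)))

  ∑ₗ-tabulate : ∀ {n} (f : A → Carrier) (g : Fin n → A) → ∑ₗ f (List.tabulate g) ≈ sum (f ∘ g)
  ∑ₗ-tabulate {n = zero}  f g = refl
  ∑ₗ-tabulate {n = suc n} f g = +-congˡ (∑ₗ-tabulate f (g ∘ Fin.suc))

  ∑ₗ-applyUpTo : ∀ (f : A → Carrier) (g : ℕ → A) m → ∑ₗ f (List.applyUpTo g m) ≈ sum {m} (λ i → f (g (toℕ i)))
  ∑ₗ-applyUpTo f g zero    = refl
  ∑ₗ-applyUpTo f g (suc m) = +-congˡ (∑ₗ-applyUpTo f (g ∘ suc) m)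

≡ᵇ-true : ∀ {m n} → m ≡ n → (m ≡ᵇ n) ≡ true
≡ᵇ-true {m} {n} m≡n = Equivalence.to T-≡ (ℕ.≡⇒≡ᵇ m n m≡n)

≡ᵇ-false : ∀ {m n} → m ≢ n → (m ≡ᵇ n) ≡ false
≡ᵇ-false {m} {n} m≢n = ¬-not (m≢n ∘ ℕ.≡ᵇ⇒≡ m n ∘ Equivalence.from T-≡)

<ᵇ-true : ∀ {m n} → m < n → (m <ᵇ n) ≡ true
<ᵇ-true m<n = Equivalence.to T-≡ (ℕ.<⇒<ᵇ m<n)

<ᵇ-false : ∀ {m n} → ¬ m < n → (m <ᵇ n) ≡ false
<ᵇ-false {m} {n} m≮n = ¬-not (m≮n ∘ ℕ.<ᵇ⇒< m n ∘ Equivalence.from T-≡)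

-- How an entry in block i relates to the blocks 0, …, j-1 opened so far.
stayClimb : ∀ {a} {A : Set a} → A → A → A → ℕ → ℕ → A
stayClimb stay climb otherwise j i = if i <ᵇ j then stay else if i ≡ᵇ j then climb else otherwise

module _ {a} {A : Set a} {x y z : A} where

  stayClimb-< : ∀ {i j} → i < j → stayClimb x y z j i ≡ x
  stayClimb-< i<j rewrite <ᵇ-true i<j = ≡.refl

  stayClimb-≡ : ∀ {i j} → i ≡ j → stayClimb x y z j i ≡ y
  stayClimb-≡ {i} ≡.refl rewrite <ᵇ-false (ℕ.<-irrefl (≡.refl {x = i})) | ≡ᵇ-true (≡.refl {x = i}) = ≡.refl

  stayClimb-> : ∀ {i j} → j < i → stayClimb x y z j i ≡ z
  stayClimb-> j<i rewrite <ᵇ-false (ℕ.<-asym j<i) | ≡ᵇ-false (ℕ.>⇒≢ j<i) = ≡.refl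

module Encoding where
  open import Data.Nat using (_+_; _*_)
  open import Algebra.Properties.CommutativeSemigroup ℕ.+-commutativeSemigroup using () renaming (interchange to +-interchange)

  module ℕSum where
    open ListSum ℕ.+-0-commutativeMonoid public
    open import Algebra.Properties.CommutativeMonoid.Sum ℕ.+-0-commutativeMonoid public
      using (sum; sum-cong-≗; sum-replicate-zero)

  Entry : ℕ → Set
  Entry k = Maybe (Fin k × Bool)

  -- The contribution 2(b+1) - [x > 0] of an entry x ∈ S_(b+1) to m(π).
  entryWeight : ∀ {k} → Entry k → ℕ
  entryWeight nothing             = 0
  entryWeight (just (b , true))  = suc (2 * toℕ b)
  entryWeight (just (b , false)) = 2 + 2 * toℕ b

  weight : ∀ {n k} → Assign n k → ℕ
  weight []      = 0
  weight (e ∷ a) = entryWeight e + weight a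

  blockLabel : ∀ {k} → Entry k → ℕ
  blockLabel nothing        = 0
  blockLabel (just (b , _)) = suc (toℕ b)

  weightedBlockSizes : ∀ {n k} → Assign n k → ℕ
  weightedBlockSizes {k = k} a = sumℕ (List.map (λ b → suc (toℕ b) * blockSize b a) (List.allFin k))

  indicator : Bool → ℕ
  indicator b = if b then 1 else 0

  sum-indicator-inBlock : ∀ {k} (f : Fin k → ℕ) (c : Fin k) (s : Bool) →
                          ℕSum.sum (λ b → f b * indicator (inBlock b (just (c , s)))) ≡ f c
  sum-indicator-inBlock {suc k} f Fin.zero s = begin
      f Fin.zero * 1 + ℕSum.sum (λ b → f (Fin.suc b) * 0)
    ≡⟨ ≡.cong₂ _+_ (ℕ.*-identityʳ _) (ℕSum.sum-cong-≗ (λ b → ℕ.*-zeroʳ (f (Fin.suc b)))) ⟩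
      f Fin.zero + ℕSum.sum {k} (λ _ → 0)
    ≡⟨ ≡.cong (f Fin.zero +_) (ℕSum.sum-replicate-zero k) ⟩
      f Fin.zero + 0
    ≡⟨ ℕ.+-identityʳ _ ⟩
      f Fin.zero
    ∎
    where open ≡.≡-Reasoning
  sum-indicator-inBlock {suc k} f (Fin.suc c) s =
    ≡.cong₂ _+_ (ℕ.*-zeroʳ (f Fin.zero)) (sum-indicator-inBlock (f ∘ Fin.suc) c s)

  weightedBlockSizes-∷ : ∀ {n k} e (a : Assign n k) →
                         weightedBlockSizes (e ∷ a) ≡ blockLabel e + weightedBlockSizes a
  weightedBlockSizes-∷ {k = k} e a = begin
      ℕSum.∑ₗ (λ b → suc (toℕ b) * (indicator (inBlock b e) + blockSize b a)) (List.allFin k)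
    ≡⟨ ℕSum.∑ₗ-cong (List.allFin k) (λ b →
         ℕ.*-distribˡ-+ (suc (toℕ b)) (indicator (inBlock b e)) (blockSize b a)) ⟩
      ℕSum.∑ₗ (λ b → suc (toℕ b) * indicator (inBlock b e) + suc (toℕ b) * blockSize b a) (List.allFin k)
    ≡⟨ ℕSum.∑ₗ-distrib-+ _ _ (List.allFin k) ⟩
      ℕSum.∑ₗ (λ b → suc (toℕ b) * indicator (inBlock b e)) (List.allFin k) + weightedBlockSizes a
    ≡⟨ ≡.cong (_+ weightedBlockSizes a) (labelled e) ⟩
      blockLabel e + weightedBlockSizes a
    ∎
    where
      open ≡.≡-Reasoning
      labelled : ∀ e → ℕSum.∑ₗ (λ b → suc (toℕ b) * indicator (inBlock b e)) (List.allFin k) ≡ blockLabel e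
      labelled nothing        = ℕSum.∑ₗ-zero (List.allFin k) (λ b → ℕ.*-zeroʳ (suc (toℕ b)))
      labelled (just (c , s)) = ≡.trans (ℕSum.∑ₗ-tabulate {n = k} _ (λ b → b)) (sum-indicator-inBlock (suc ∘ toℕ) c s)

  double-blockLabel : ∀ {k} (e : Entry k) → 2 * blockLabel e ≡ entryWeight e + indicator (isPos e)
  double-blockLabel nothing            = ≡.refl
  double-blockLabel (just (b , true))  = ≡.trans (ℕ.*-suc 2 (toℕ b)) (≡.cong suc (ℕ.+-comm 1 (2 * toℕ b)))
  double-blockLabel (just (b , false)) = ≡.trans (ℕ.*-suc 2 (toℕ b)) (≡.sym (ℕ.+-identityʳ _))

  double-weightedBlockSizes : ∀ {n k} (a : Assign n k) → 2 * weightedBlockSizes a ≡ weight a + pos a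
  double-weightedBlockSizes {k = k} [] =
    ≡.cong (2 *_) (ℕSum.∑ₗ-zero (List.allFin k) (λ b → ℕ.*-zeroʳ (suc (toℕ b))))
  double-weightedBlockSizes (e ∷ a) = begin
      2 * weightedBlockSizes (e ∷ a)
    ≡⟨ ≡.cong (2 *_) (weightedBlockSizes-∷ e a) ⟩
      2 * (blockLabel e + weightedBlockSizes a)
    ≡⟨ ℕ.*-distribˡ-+ 2 (blockLabel e) _ ⟩
      2 * blockLabel e + 2 * weightedBlockSizes a
    ≡⟨ ≡.cong₂ _+_ (double-blockLabel e) (double-weightedBlockSizes a) ⟩
      entryWeight e + indicator (isPos e) + (weight a + pos a)
    ≡⟨ +-interchange (entryWeight e) _ _ _ ⟩
      weight (e ∷ a) + pos (e ∷ a)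
    ∎
    where open ≡.≡-Reasoning

  mStat≡weight : ∀ {n k} (a : Assign n k) → mStat a ≡ weight a
  mStat≡weight a = ≡.trans (≡.cong (_∸ pos a) (double-weightedBlockSizes a)) (ℕ.m+n∸n≡m (weight a) (pos a))

  -- Reading a from the left with blocks 0, …, j-1 already opened: every entry lies in an
  -- opened block or opens block j, and all k blocks are open at the end.
  restrictedGrowth : ∀ {n k} → ℕ → Assign n k → Bool
  restrictedGrowth {k = k} j []                 = j ≡ᵇ k
  restrictedGrowth j (nothing ∷ a)              = restrictedGrowth j a
  restrictedGrowth j (just (b , _) ∷ a) = stayClimb (restrictedGrowth j a) (restrictedGrowth (suc j) a) false j (toℕ b)

  restrictedGrowth-above : ∀ {n k} j (a : Assign n k) → k < j → restrictedGrowth j a ≡ false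
  restrictedGrowth-above j []                 k<j = ≡ᵇ-false (ℕ.>⇒≢ k<j)
  restrictedGrowth-above j (nothing ∷ a)      k<j = restrictedGrowth-above j a k<j
  restrictedGrowth-above j (just (b , _) ∷ a) k<j =
    ≡.trans (stayClimb-< (ℕ.<-trans (toℕ<n b) k<j)) (restrictedGrowth-above j a k<j)

  inBlockℕ : ∀ {k} → ℕ → Entry k → Bool
  inBlockℕ x nothing        = false
  inBlockℕ x (just (c , _)) = x ≡ᵇ toℕ c

  firstOccurrence : ∀ {n k} → ℕ → ℕ → Assign n k → Maybe ℕ
  firstOccurrence o x []      = nothing
  firstOccurrence o x (e ∷ a) = if inBlockℕ x e then just o else firstOccurrence (suc o) x a

  firstOccurrences : ∀ {n k} → ℕ → ℕ → ℕ → Assign n k → List (Maybe ℕ)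
  firstOccurrences o j zero    a = []
  firstOccurrences o j (suc m) a = firstOccurrence o j a ∷ firstOccurrences o (suc j) m a

  blockMinFrom≡firstOccurrence : ∀ {n k} o (b : Fin k) (a : Assign n k) →
                                 blockMinFrom o b a ≡ firstOccurrence o (toℕ b) a
  blockMinFrom≡firstOccurrence o b []                 = ≡.refl
  blockMinFrom≡firstOccurrence o b (nothing ∷ a)      = blockMinFrom≡firstOccurrence (suc o) b a
  blockMinFrom≡firstOccurrence o b (just (c , _) ∷ a) =
    ≡.cong (if toℕ b ≡ᵇ toℕ c then just o else_) (blockMinFrom≡firstOccurrence (suc o) b a)

  tabulate-firstOccurrence : ∀ {n k} o j m (a : Assign n k) →
                             List.tabulate {n = m} (λ b → firstOccurrence o (j + toℕ b) a) ≡ firstOccurrences o j m a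
  tabulate-firstOccurrence o j zero    a = ≡.refl
  tabulate-firstOccurrence o j (suc m) a = ≡.cong₂ _∷_
    (≡.cong (λ x → firstOccurrence o x a) (ℕ.+-identityʳ j))
    (≡.trans (List.tabulate-cong (λ b → ≡.cong (λ x → firstOccurrence o x a) (ℕ.+-suc j (toℕ b))))
           (tabulate-firstOccurrence o (suc j) m a))

  blockMins≡firstOccurrences : ∀ {n k} (a : Assign n k) → blockMins a ≡ firstOccurrences 1 0 k a
  blockMins≡firstOccurrences {k = k} a = begin
      List.map (λ b → blockMin b a) (List.allFin k)
    ≡⟨ List.map-tabulate (λ b → b) (λ b → blockMin b a) ⟩
      List.tabulate (λ b → blockMin b a)
    ≡⟨ List.tabulate-cong (λ b → blockMinFrom≡firstOccurrence 1 b a) ⟩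
      List.tabulate (λ b → firstOccurrence 1 (toℕ b) a)
    ≡⟨ tabulate-firstOccurrence 1 0 k a ⟩
      firstOccurrences 1 0 k a
    ∎
    where open ≡.≡-Reasoning

  firstOccurrence-≥ : ∀ {n k} o x (a : Assign n k) → AllMaybe (o ≤_) (firstOccurrence o x a)
  firstOccurrence-≥ o x []      = nothing
  firstOccurrence-≥ o x (e ∷ a) with inBlockℕ x e
  ... | true  = just ℕ.≤-refl
  ... | false = Maybe.map (ℕ.≤-trans (ℕ.n≤1+n o)) (firstOccurrence-≥ (suc o) x a)

  ∈-firstOccurrences : ∀ {n k} o j m x (a : Assign n k) → j ≤ x → x < j + m →
                       firstOccurrence o x a ∈ firstOccurrences o j m a
  ∈-firstOccurrences o j zero    x a j≤x x<j+0 = contradiction j≤x (ℕ.<⇒≱ (≡.subst (x <_) (ℕ.+-identityʳ j) x<j+0))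
  ∈-firstOccurrences o j (suc m) x a j≤x x<j+m with ℕ.m≤n⇒m<n∨m≡n j≤x
  ... | inj₂ ≡.refl = here ≡.refl
  ... | inj₁ j<x  = there (∈-firstOccurrences o (suc j) m x a j<x (≡.subst (x <_) (ℕ.+-suc j m) x<j+m))

  firstOccurrences-skip : ∀ {n k} o j m e (a : Assign n k) → (∀ x → j ≤ x → inBlockℕ x e ≡ false) →
                          firstOccurrences o j m (e ∷ a) ≡ firstOccurrences (suc o) j m a
  firstOccurrences-skip o j zero    e a outside = ≡.refl
  firstOccurrences-skip o j (suc m) e a outside = ≡.cong₂ _∷_
    (≡.cong (if_then just o else firstOccurrence (suc o) j a) (outside j ℕ.≤-refl))
    (firstOccurrences-skip o (suc j) m e a (λ x j<x → outside x (ℕ.<⇒≤ j<x)))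

  nondecreasing-≤ : ∀ y T → nondecreasing (just y ∷ T) ≡ true → ∀ z → just z ∈ T → y ≤ z
  nondecreasing-≤ y (just z ∷ T) nd z (here ≡.refl) with y ≤ᵇ z in y≤ᵇz
  ... | true = ℕ.≤ᵇ⇒≤ y z (Equivalence.from T-≡ y≤ᵇz)
  nondecreasing-≤ y (just w ∷ T) nd z (there z∈T) with y ≤ᵇ w in y≤ᵇw
  ... | true = ℕ.≤-trans (ℕ.≤ᵇ⇒≤ y w (Equivalence.from T-≡ y≤ᵇw)) (nondecreasing-≤ w T nd z z∈T)

  nondecreasing-∷ : ∀ o h T → AllMaybe (o ≤_) h → nondecreasing (just o ∷ h ∷ T) ≡ nondecreasing (h ∷ T)
  nondecreasing-∷ o nothing  T nothing    = ≡.refl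
  nondecreasing-∷ o (just y) T (just o≤y) =
    ≡.cong (_∧ nondecreasing (just y ∷ T)) (Equivalence.to T-≡ (ℕ.≤⇒≤ᵇ o≤y))

  nondecreasing-∉ : ∀ o h T → AllMaybe (suc o ≤_) h → just o ∈ T → nondecreasing (h ∷ T) ≡ false
  nondecreasing-∉ o nothing  T nothing    o∈T = ≡.refl
  nondecreasing-∉ o (just y) T (just o<y) o∈T with nondecreasing (just y ∷ T) in nd
  ... | true  = contradiction (nondecreasing-≤ y T nd o o∈T) (ℕ.<⇒≱ o<y)
  ... | false = ≡.refl

  nondecreasing-∷-firstOccurrences : ∀ {n k} o j m (a : Assign n k) →
    nondecreasing (just o ∷ firstOccurrences (suc o) j m a) ≡ nondecreasing (firstOccurrences (suc o) j m a)
  nondecreasing-∷-firstOccurrences o j zero    a = ≡.refl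
  nondecreasing-∷-firstOccurrences o j (suc m) a =
    nondecreasing-∷ o _ _ (Maybe.map (ℕ.≤-trans (ℕ.n≤1+n o)) (firstOccurrence-≥ (suc o) j a))

  nondecreasing-firstOccurrences : ∀ {n k} (a : Assign n k) o j → j ≤ k →
                                   nondecreasing (firstOccurrences o j (k ∸ j) a) ≡ restrictedGrowth j a
  nondecreasing-firstOccurrences {k = k} [] o j j≤k with ℕ.m≤n⇒m<n∨m≡n j≤k
  ... | inj₂ ≡.refl = ≡.trans (≡.cong (λ m → nondecreasing (firstOccurrences {k = k} o j m [])) (ℕ.n∸n≡0 j))
                              (≡.sym (≡ᵇ-true {j} ≡.refl))
  ... | inj₁ j<k    = ≡.trans (≡.cong (λ m → nondecreasing (firstOccurrences {k = k} o j m [])) (ℕ.+-∸-assoc 1 j<k))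
                              (≡.sym (≡ᵇ-false (ℕ.<⇒≢ j<k)))
  nondecreasing-firstOccurrences {k = k} (nothing ∷ a) o j j≤k =
    ≡.trans (≡.cong nondecreasing (firstOccurrences-skip o j (k ∸ j) nothing a (λ _ _ → ≡.refl)))
          (nondecreasing-firstOccurrences a (suc o) j j≤k)
  nondecreasing-firstOccurrences {k = k} (just (c , s) ∷ a) o j j≤k with ℕ.<-cmp (toℕ c) j
  ... | tri< c<j _ _ = begin
      nondecreasing (firstOccurrences o j (k ∸ j) (just (c , s) ∷ a))
    ≡⟨ ≡.cong nondecreasing (firstOccurrences-skip o j (k ∸ j) (just (c , s)) a
         (λ x j≤x → ≡ᵇ-false (λ x≡c → ℕ.<⇒≱ c<j (≡.subst (j ≤_) x≡c j≤x)))) ⟩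
      nondecreasing (firstOccurrences (suc o) j (k ∸ j) a)
    ≡⟨ nondecreasing-firstOccurrences a (suc o) j j≤k ⟩
      restrictedGrowth j a
    ≡⟨ stayClimb-< c<j ⟨
      restrictedGrowth j (just (c , s) ∷ a)
    ∎
    where open ≡.≡-Reasoning
  ... | tri≈ _ c≡j _ = begin
      nondecreasing (firstOccurrences o j (k ∸ j) (just (c , s) ∷ a))
    ≡⟨ ≡.cong (λ m → nondecreasing (firstOccurrences o j m (just (c , s) ∷ a))) (ℕ.+-∸-assoc 1 j<k) ⟩
      nondecreasing (firstOccurrence o j (just (c , s) ∷ a) ∷ firstOccurrences o (suc j) m (just (c , s) ∷ a))
    ≡⟨ ≡.cong nondecreasing (≡.cong₂ _∷_
         (≡.cong (if_then just o else firstOccurrence (suc o) j a) (≡ᵇ-true (≡.sym c≡j)))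
         (firstOccurrences-skip o (suc j) m (just (c , s)) a
           (λ x j<x → ≡ᵇ-false (λ x≡c → ℕ.<⇒≢ j<x (≡.trans (≡.sym c≡j) (≡.sym x≡c)))))) ⟩
      nondecreasing (just o ∷ firstOccurrences (suc o) (suc j) m a)
    ≡⟨ nondecreasing-∷-firstOccurrences o (suc j) m a ⟩
      nondecreasing (firstOccurrences (suc o) (suc j) m a)
    ≡⟨ nondecreasing-firstOccurrences a (suc o) (suc j) j<k ⟩
      restrictedGrowth (suc j) a
    ≡⟨ stayClimb-≡ c≡j ⟨
      restrictedGrowth j (just (c , s) ∷ a)
    ∎
    where
      open ≡.≡-Reasoning
      j<k : j < k
      j<k = ≡.subst (_< k) c≡j (toℕ<n c)
      m = k ∸ suc j
  ... | tri> _ _ j<c = begin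
      nondecreasing (firstOccurrences o j (k ∸ j) (just (c , s) ∷ a))
    ≡⟨ ≡.cong (λ m → nondecreasing (firstOccurrences o j m (just (c , s) ∷ a))) (ℕ.+-∸-assoc 1 j<k) ⟩
      nondecreasing (firstOccurrence o j (just (c , s) ∷ a) ∷ firstOccurrences o (suc j) m (just (c , s) ∷ a))
    ≡⟨ nondecreasing-∉ o _ _ head-later c-first ⟩
      false
    ≡⟨ stayClimb-> j<c ⟨
      restrictedGrowth j (just (c , s) ∷ a)
    ∎
    where
      open ≡.≡-Reasoning
      j<k : j < k
      j<k = ℕ.<-trans j<c (toℕ<n c)
      m = k ∸ suc j
      head-later : AllMaybe (suc o ≤_) (firstOccurrence o j (just (c , s) ∷ a))
      head-later = ≡.subst (AllMaybe (suc o ≤_))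
                           (≡.sym (≡.cong (if_then just o else firstOccurrence (suc o) j a) (≡ᵇ-false (ℕ.<⇒≢ j<c))))
                           (firstOccurrence-≥ (suc o) j a)
      c-first : just o ∈ firstOccurrences o (suc j) m (just (c , s) ∷ a)
      c-first = ≡.subst (_∈ firstOccurrences o (suc j) m (just (c , s) ∷ a))
                        (≡.cong (if_then just o else firstOccurrence (suc o) (toℕ c) a) (≡ᵇ-true {toℕ c} ≡.refl))
                        (∈-firstOccurrences o (suc j) m (toℕ c) (just (c , s) ∷ a) j<c
                          (≡.subst (toℕ c <_) (≡.sym (ℕ.m+[n∸m]≡n j<k)) (toℕ<n c)))

  isPSSP≡restrictedGrowth : ∀ {n k} (a : Assign n k) → isPSSP a ≡ restrictedGrowth 0 a
  isPSSP≡restrictedGrowth a =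
    ≡.trans (≡.cong nondecreasing (blockMins≡firstOccurrences a)) (nondecreasing-firstOccurrences a 1 0 z≤n)

open Encoding

module _ {c ℓ} (R : CommutativeRing c ℓ) where
  open CommutativeRing R
  open QStirling R
  open import Algebra.Properties.Semiring.Sum semiring
    using (sum; sum-cong-≋; sum-replicate; sum-replicate-zero; ∑-distrib-+; *-distribˡ-sum)
  open import Algebra.Properties.Semiring.Exp semiring using (^-homo-*)
  open import Algebra.Properties.Semiring.Mult semiring using (×-homo-+; ×-comm-*; ×-congʳ; ×-congˡ)
  open import Algebra.Properties.CommutativeMonoid.Mult +-commutativeMonoid using (×-distrib-+)
  open import Algebra.Solver.Ring.NaturalCoefficients.Default commutativeSemiring
  open import Relation.Binary.Reasoning.Setoid setoid
  open ListSum +-commutativeMonoid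

  *-distribˡ-∑ₗ : ∀ {A : Set} x (f : A → Carrier) xs → x * ∑ₗ f xs ≈ ∑ₗ (λ a → x * f a) xs
  *-distribˡ-∑ₗ x f []       = zeroʳ x
  *-distribˡ-∑ₗ x f (a ∷ xs) = trans (distribˡ x _ _) (+-congˡ (*-distribˡ-∑ₗ x f xs))

  sumBelow : ℕ → (ℕ → Carrier) → Carrier
  sumBelow m f = sum {m} (λ i → f (toℕ i))

  infix 7.5 sumBelow
  syntax sumBelow m (λ i → x) = ∑ℕ[ i < m ] x

  sumBelow-cong : ∀ m {f g : ℕ → Carrier} → (∀ i → f i ≈ g i) → sumBelow m f ≈ sumBelow m g
  sumBelow-cong m f≈g = sum-cong-≋ {m} (f≈g ∘ toℕ)

  sumBelow-zero : ∀ m {f : ℕ → Carrier} → (∀ i → i < m → f i ≈ 0#) → sumBelow m f ≈ 0#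
  sumBelow-zero zero    f≈0 = refl
  sumBelow-zero (suc m) f≈0 =
    trans (+-cong (f≈0 0 (s≤s z≤n)) (sumBelow-zero m (λ i i<m → f≈0 (suc i) (s≤s i<m)))) (+-identityˡ 0#)

  sumBelow-+ : ∀ m (f g : ℕ → Carrier) → ∑ℕ[ i < m ] (f i + g i) ≈ sumBelow m f + sumBelow m g
  sumBelow-+ m f g = ∑-distrib-+ {m} (f ∘ toℕ) (g ∘ toℕ)

  *-distribˡ-sumBelow : ∀ m x (f : ℕ → Carrier) → x * sumBelow m f ≈ ∑ℕ[ i < m ] (x * f i)
  *-distribˡ-sumBelow m x f = *-distribˡ-sum {m} x (f ∘ toℕ)

  sumBelow-snoc : ∀ m (f : ℕ → Carrier) → sumBelow (suc m) f ≈ sumBelow m f + f m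
  sumBelow-snoc zero    f = +-comm _ _
  sumBelow-snoc (suc m) f = trans (+-congˡ (sumBelow-snoc m (f ∘ suc))) (sym (+-assoc _ _ _))

  sumBelow-split : ∀ m n (f : ℕ → Carrier) → sumBelow (m ℕ.+ n) f ≈ sumBelow m f + ∑ℕ[ i < n ] f (m ℕ.+ i)
  sumBelow-split zero    n f = sym (+-identityˡ _)
  sumBelow-split (suc m) n f = trans (+-congˡ (sumBelow-split m n (f ∘ suc))) (sym (+-assoc _ _ _))

  δ : ℕ → ℕ → Carrier
  δ j k = if j ≡ᵇ k then 1# else 0#

  δ-subst : ∀ (f : ℕ → Carrier) j k → f j * δ j k ≈ f k * δ j k
  δ-subst f j k with j ℕ.≟ k
  ... | yes ≡.refl = refl
  ... | no j≢k rewrite ≡ᵇ-false j≢k = trans (zeroʳ _) (sym (zeroʳ _))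

  -- paths n j k sums, over the words of length n that climb from level j to level k in unit
  -- steps, the product of the weights stay i / step i of the letters read at level i.
  module Paths (stay step : ℕ → Carrier) where

    paths : ℕ → ℕ → ℕ → Carrier
    paths zero    j k = δ j k
    paths (suc n) j k = stay j * paths n j k + step j * paths n (suc j) k

    paths-below : ∀ n j k → k < j → paths n j k ≈ 0#
    paths-below zero    j k k<j = reflexive (≡.cong (if_then 1# else 0#) (≡ᵇ-false (ℕ.>⇒≢ k<j)))
    paths-below (suc n) j k k<j = begin
      stay j * paths n j k + step j * paths n (suc j) k
        ≈⟨ +-cong (*-congˡ (paths-below n j k k<j)) (*-congˡ (paths-below n (suc j) k (ℕ.m<n⇒m<1+n k<j))) ⟩
      stay j * 0# + step j * 0#
        ≈⟨ solve 2 (λ s t → s :* con 0 :+ t :* con 0 := con 0) refl (stay j) (step j) ⟩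
      0# ∎

    paths-last₀ : ∀ n j → paths (suc n) j 0 ≈ stay 0 * paths n j 0
    paths-last₀ zero    j = trans (+-cong (δ-subst stay j 0) (zeroʳ (step j))) (+-identityʳ _)
    paths-last₀ (suc n) j = begin
      stay j * paths (suc n) j 0 + step j * paths (suc n) (suc j) 0
        ≈⟨ +-cong (*-congˡ (paths-last₀ n j)) (*-congˡ (paths-last₀ n (suc j))) ⟩
      stay j * (stay 0 * paths n j 0) + step j * (stay 0 * paths n (suc j) 0)
        ≈⟨ solve 5 (λ s t s₀ a b → s :* (s₀ :* a) :+ t :* (s₀ :* b) := s₀ :* (s :* a :+ t :* b))
                 refl (stay j) (step j) (stay 0) (paths n j 0) (paths n (suc j) 0) ⟩
      stay 0 * paths (suc n) j 0 ∎

    paths-last : ∀ n j k → paths (suc n) j (suc k) ≈ step k * paths n j k + stay (suc k) * paths n j (suc k)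
    paths-last zero    j k = trans (+-cong (δ-subst stay j (suc k)) (δ-subst step j k)) (+-comm _ _)
    paths-last (suc n) j k = begin
      stay j * paths (suc n) j (suc k) + step j * paths (suc n) (suc j) (suc k)
        ≈⟨ +-cong (*-congˡ (paths-last n j k)) (*-congˡ (paths-last n (suc j) k)) ⟩
      stay j * (step k * x₀ + stay (suc k) * x₁) + step j * (step k * y₀ + stay (suc k) * y₁)
        ≈⟨ solve 8 (λ s t s′ t′ a b c d → s :* (t′ :* a :+ s′ :* b) :+ t :* (t′ :* c :+ s′ :* d)
                                        := t′ :* (s :* a :+ t :* c) :+ s′ :* (s :* b :+ t :* d))
                 refl (stay j) (step j) (stay (suc k)) (step k) x₀ x₁ y₀ y₁ ⟩
      step k * paths (suc n) j k + stay (suc k) * paths (suc n) j (suc k) ∎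
      where
        x₀ = paths n j k
        x₁ = paths n j (suc k)
        y₀ = paths n (suc j) k
        y₁ = paths n (suc j) (suc k)

    -- Reading the last letter instead of the first characterises the paths from level 0.
    paths-from-0 : (T : ℕ → ℕ → Carrier) → (∀ k → T 0 k ≈ δ 0 k) →
                   (∀ n → T (suc n) 0 ≈ stay 0 * T n 0) →
                   (∀ n k → T (suc n) (suc k) ≈ step k * T n k + stay (suc k) * T n (suc k)) →
                   ∀ n k → paths n 0 k ≈ T n k
    paths-from-0 T T-init T-last₀ T-last = go
      where
        go : ∀ n k → paths n 0 k ≈ T n k
        go zero    k       = sym (T-init k)
        go (suc n) zero    = trans (paths-last₀ n 0) (trans (*-congˡ (go n 0)) (sym (T-last₀ n)))
        go (suc n) (suc k) =
          trans (paths-last n 0 k) (trans (+-cong (*-congˡ (go n k)) (*-congˡ (go n (suc k)))) (sym (T-last n k)))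

  stayClimb-cong : ∀ {X X′ Y Y′} j i → X ≈ X′ → Y ≈ Y′ → stayClimb X Y 0# j i ≈ stayClimb X′ Y′ 0# j i
  stayClimb-cong j i X≈X′ Y≈Y′ with i <ᵇ j | i ≡ᵇ j
  ... | true  | _     = X≈X′
  ... | false | true  = Y≈Y′
  ... | false | false = refl

  stayClimb-zero : ∀ {X Y} j i → X ≈ 0# → Y ≈ 0# → stayClimb X Y 0# j i ≈ 0#
  stayClimb-zero j i X≈0 Y≈0 with i <ᵇ j | i ≡ᵇ j
  ... | true  | _     = X≈0
  ... | false | true  = Y≈0
  ... | false | false = refl

  sum-stayClimb : ∀ (w : ℕ → Carrier) X Y j m → j < m →
    ∑ℕ[ i < m ] (w i * stayClimb X Y 0# j i) ≈ ∑ℕ[ i < j ] w i * X + w j * Y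
  sum-stayClimb w X Y zero (suc m) _ = begin
    w 0 * Y + ∑ℕ[ i < m ] (w (suc i) * 0#)  ≈⟨ +-congˡ (sumBelow-zero m (λ i _ → zeroʳ (w (suc i)))) ⟩
    w 0 * Y + 0#                           ≈⟨ solve 2 (λ a x → a :+ con 0 := con 0 :* x :+ a) refl (w 0 * Y) X ⟩
    0# * X + w 0 * Y                       ∎
  sum-stayClimb w X Y (suc j) (suc m) (s≤s j<m) = begin
    w 0 * X + ∑ℕ[ i < m ] (w (suc i) * stayClimb X Y 0# j i)  ≈⟨ +-congˡ (sum-stayClimb (w ∘ suc) X Y j m j<m) ⟩
    w 0 * X + (∑ℕ[ i < j ] w (suc i) * X + w (suc j) * Y)
      ≈⟨ solve 5 (λ a x b d y → a :* x :+ (b :* x :+ d :* y) := (a :+ b) :* x :+ d :* y)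
               refl (w 0) X (∑ℕ[ i < j ] w (suc i)) (w (suc j)) Y ⟩
    (w 0 + ∑ℕ[ i < j ] w (suc i)) * X + w (suc j) * Y ∎

  sum-stayClimb-top : ∀ (w : ℕ → Carrier) X Y j →
    ∑ℕ[ i < j ] (w i * stayClimb X Y 0# j i) ≈ ∑ℕ[ i < j ] w i * X
  sum-stayClimb-top w X Y zero    = sym (zeroˡ X)
  sum-stayClimb-top w X Y (suc j) =
    trans (+-congˡ (sum-stayClimb-top (w ∘ suc) X Y j)) (sym (distribʳ _ _ _))

  qint-snoc : ∀ x m → qint x (suc m) ≈ qint x m + x ^ m
  qint-snoc x zero    = solve 1 (λ x → con 1 :+ x :* con 0 := con 0 :+ con 1) refl x
  qint-snoc x (suc m) = begin
    1# + x * qint x (suc m)        ≈⟨ +-congˡ (*-congˡ (qint-snoc x m)) ⟩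
    1# + x * (qint x m + x ^ m)    ≈⟨ solve 3 (λ x a b → con 1 :+ x :* (a :+ b) := (con 1 :+ x :* a) :+ x :* b)
                                            refl x (qint x m) (x ^ m) ⟩
    qint x (suc m) + x ^ suc m     ∎

  ×-zeroʳ : ∀ n → n ·ℕ 0# ≈ 0#
  ×-zeroʳ zero    = refl
  ×-zeroʳ (suc n) = trans (+-identityˡ _) (×-zeroʳ n)

  binomialTransform : (ℕ → Carrier) → ℕ → Carrier
  binomialTransform U n = ∑ℕ[ j < suc n ] (n C j) ·ℕ U j

  module _ {U V : ℕ → Carrier} where

    binomialTransform-cong : (∀ j → U j ≈ V j) → ∀ n → binomialTransform U n ≈ binomialTransform V n
    binomialTransform-cong U≈V n = sumBelow-cong (suc n) (λ j → ×-congʳ (n C j) (U≈V j))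

    binomialTransform-+ : ∀ n → binomialTransform (λ j → U j + V j) n ≈ binomialTransform U n + binomialTransform V n
    binomialTransform-+ n = trans (sumBelow-cong (suc n) (λ j → ×-distrib-+ (U j) (V j) (n C j)))
                                  (sumBelow-+ (suc n) (λ j → (n C j) ·ℕ U j) (λ j → (n C j) ·ℕ V j))

  binomialTransform-* : ∀ x (U : ℕ → Carrier) n → binomialTransform (λ j → x * U j) n ≈ x * binomialTransform U n
  binomialTransform-* x U n = trans (sumBelow-cong (suc n) (λ j → sym (×-comm-* (n C j) x (U j))))
                                    (sym (*-distribˡ-sumBelow (suc n) x (λ j → (n C j) ·ℕ U j)))

  binomialTransform-zero : ∀ (U : ℕ → Carrier) → (∀ j → U j ≈ 0#) → ∀ n → binomialTransform U n ≈ 0#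
  binomialTransform-zero U U≈0 n = sumBelow-zero (suc n) (λ j _ → trans (×-congʳ (n C j) (U≈0 j)) (×-zeroʳ (n C j)))

  binomialTransform-0 : ∀ (U : ℕ → Carrier) → binomialTransform U 0 ≈ U 0
  binomialTransform-0 U = trans (+-identityʳ _) (+-identityʳ (U 0))

  nC0≡1 : ∀ n → n C 0 ≡ 1
  nC0≡1 n = ≡.trans (nCk≡nC[n∸k] {k = 0} {n = n} z≤n) (nCn≡1 n)

  binomialTransform-suc : ∀ (U : ℕ → Carrier) n →
    binomialTransform U (suc n) ≈ binomialTransform U n + binomialTransform (U ∘ suc) n
  binomialTransform-suc U n = begin
      (suc n C 0) ·ℕ U 0 + ∑ℕ[ j < suc n ] (suc n C suc j) ·ℕ U (suc j)
    ≈⟨ +-cong (×-congˡ (nC0≡1 (suc n))) (sumBelow-cong (suc n) (λ j →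
         trans (×-congˡ (≡.sym (nCk+nC[k+1]≡[n+1]C[k+1] n j))) (×-homo-+ (U (suc j)) (n C j) (n C suc j)))) ⟩
      1 ·ℕ U 0 + ∑ℕ[ j < suc n ] ((n C j) ·ℕ U (suc j) + (n C suc j) ·ℕ U (suc j))
    ≈⟨ +-congˡ (sumBelow-+ (suc n) (λ j → (n C j) ·ℕ U (suc j)) later) ⟩
      1 ·ℕ U 0 + (binomialTransform (U ∘ suc) n + ∑ℕ[ j < suc n ] later j)
    ≈⟨ +-congˡ (+-congˡ (sumBelow-snoc n later)) ⟩
      1 ·ℕ U 0 + (binomialTransform (U ∘ suc) n + (∑ℕ[ j < n ] later j + (n C suc n) ·ℕ U (suc n)))
    ≈⟨ +-congˡ (+-congˡ (+-congˡ (×-congˡ (k>n⇒nCk≡0 (ℕ.n<1+n n))))) ⟩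
      1 ·ℕ U 0 + (binomialTransform (U ∘ suc) n + (∑ℕ[ j < n ] later j + 0#))
    ≈⟨ solve 3 (λ a b c → a :+ (b :+ (c :+ con 0)) := (a :+ c) :+ b) refl (1 ·ℕ U 0) (binomialTransform (U ∘ suc) n) _ ⟩
      (1 ·ℕ U 0 + ∑ℕ[ j < n ] later j) + binomialTransform (U ∘ suc) n
    ≈⟨ +-congʳ (+-congʳ (×-congˡ (≡.sym (nC0≡1 n)))) ⟩
      binomialTransform U n + binomialTransform (U ∘ suc) n
    ∎
    where
      later : ℕ → Carrier
      later j = (n C suc j) ·ℕ U (suc j)

  S-below : ∀ x j k → j < k → S x j k ≈ 0#
  S-below x zero    (suc k) j<k       = refl
  S-below x (suc j) (suc k) (s≤s j<k) =
    trans (+-cong (S-below x j k j<k) (trans (*-congˡ (S-below x j (suc k) (ℕ.m<n⇒m<1+n j<k))) (zeroʳ _)))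
          (+-identityˡ 0#)

  module _ (q : Carrier) where

    signedWeight : ℕ → Carrier
    signedWeight i = q ^ suc (2 ℕ.* i) + q ^ suc (suc (2 ℕ.* i))

    sum-signedWeight : ∀ j → ∑ℕ[ i < j ] signedWeight i ≈ q * qint q (2 ℕ.* j)
    sum-signedWeight zero    = sym (zeroʳ q)
    sum-signedWeight (suc j) = begin
        ∑ℕ[ i < suc j ] signedWeight i
      ≈⟨ sumBelow-snoc j signedWeight ⟩
        ∑ℕ[ i < j ] signedWeight i + signedWeight j
      ≈⟨ +-congʳ (sum-signedWeight j) ⟩
        q * qint q (2 ℕ.* j) + (q ^ suc (2 ℕ.* j) + q ^ suc (suc (2 ℕ.* j)))
      ≈⟨ solve 3 (λ q a b → q :* a :+ (q :* b :+ q :* (q :* b)) := q :* ((a :+ b) :+ q :* b))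
               refl q (qint q (2 ℕ.* j)) (q ^ (2 ℕ.* j)) ⟩
        q * ((qint q (2 ℕ.* j) + q ^ (2 ℕ.* j)) + q ^ suc (2 ℕ.* j))
      ≈⟨ *-congˡ (trans (+-congʳ (sym (qint-snoc q (2 ℕ.* j)))) (sym (qint-snoc q (suc (2 ℕ.* j))))) ⟩
        q * qint q (suc (suc (2 ℕ.* j)))
      ≡⟨ ≡.cong (λ t → q * qint q t) (≡.sym (ℕ.*-suc 2 j)) ⟩
        q * qint q (2 ℕ.* suc j)
      ∎

    qint-double : ∀ m → qint q (2 ℕ.* m) ≈ qint q 2 * qint (q * q) m
    qint-double zero    = sym (zeroʳ _)
    qint-double (suc m) = begin
        qint q (2 ℕ.* suc m)
      ≡⟨ ≡.cong (qint q) (ℕ.*-suc 2 m) ⟩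
        1# + q * (1# + q * qint q (2 ℕ.* m))
      ≈⟨ +-congˡ (*-congˡ (+-congˡ (*-congˡ (qint-double m)))) ⟩
        1# + q * (1# + q * (qint q 2 * qint (q * q) m))
      ≈⟨ solve 2 (λ q y → con 1 :+ q :* (con 1 :+ q :* ((con 1 :+ q :* (con 1 :+ q :* con 0)) :* y))
                         := (con 1 :+ q :* (con 1 :+ q :* con 0)) :* (con 1 :+ (q :* q) :* y)) refl q (qint (q * q) m) ⟩
        qint q 2 * qint (q * q) (suc m)
      ∎

    signedWeight*DNorm : ∀ k → signedWeight k * DNorm q k ≈ DNorm q (suc k)
    signedWeight*DNorm k = begin
        (q ^ suc (2 ℕ.* k) + q ^ suc (suc (2 ℕ.* k))) * (q ^ (k ℕ.* k) * (qint q 2 ^ k))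
      ≈⟨ solve 4 (λ a q b t → (a :+ q :* a) :* (b :* t) := (a :* b) :* ((con 1 :+ q :* (con 1 :+ q :* con 0)) :* t))
               refl (q ^ suc (2 ℕ.* k)) q (q ^ (k ℕ.* k)) (qint q 2 ^ k) ⟩
        (q ^ suc (2 ℕ.* k) * q ^ (k ℕ.* k)) * (qint q 2 * qint q 2 ^ k)
      ≈⟨ *-congʳ (sym (^-homo-* q (suc (2 ℕ.* k)) (k ℕ.* k))) ⟩
        q ^ (suc (2 ℕ.* k) ℕ.+ k ℕ.* k) * (qint q 2 * qint q 2 ^ k)
      ≡⟨ ≡.cong (λ e → q ^ e * (qint q 2 * qint q 2 ^ k)) square-suc ⟩
        DNorm q (suc k)
      ∎
      where
        square-suc : suc (2 ℕ.* k) ℕ.+ k ℕ.* k ≡ suc k ℕ.* suc k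
        square-suc = ≡.cong suc (≡.trans (≡.cong (λ t → k ℕ.+ t ℕ.+ k ℕ.* k) (ℕ.+-identityʳ k))
                                  (≡.trans (ℕ.+-assoc k k (k ℕ.* k)) (≡.cong (k ℕ.+_) (≡.sym (ℕ.*-suc k k)))))

    stirlingTerm : ℕ → ℕ → Carrier
    stirlingTerm k j = (qint q 2 ^ (j ∸ k)) * (q ^ (j ∸ k)) * S (q * q) j k

    stirlingTerm-suc : ∀ k j →
      stirlingTerm (suc k) (suc j) ≈ stirlingTerm k j + (qint q 2 * q) * qint (q * q) (suc k) * stirlingTerm (suc k) j
    stirlingTerm-suc k j with k ℕ.<? j
    ... | yes k<j = begin
        t ^ (j ∸ k) * q ^ (j ∸ k) * (S (q * q) j k + Q * X)
      ≈⟨ distribˡ _ _ _ ⟩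
        stirlingTerm k j + t ^ (j ∸ k) * q ^ (j ∸ k) * (Q * X)
      ≡⟨ ≡.cong (λ e → stirlingTerm k j + t ^ e * q ^ e * (Q * X)) (ℕ.+-∸-assoc 1 k<j) ⟩
        stirlingTerm k j + (t * t ^ e) * (q * q ^ e) * (Q * X)
      ≈⟨ +-congˡ (solve 6 (λ t q Q X a b → (t :* a) :* (q :* b) :* (Q :* X) := ((t :* q) :* Q) :* (a :* b :* X))
                        refl t q Q X (t ^ e) (q ^ e)) ⟩
        stirlingTerm k j + (t * q) * Q * stirlingTerm (suc k) j
      ∎
      where
        t = qint q 2
        Q = qint (q * q) (suc k)
        X = S (q * q) j (suc k)
        e = j ∸ suc k
    ... | no k≮j = begin
        t ^ (j ∸ k) * q ^ (j ∸ k) * (S (q * q) j k + Q * X)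
      ≈⟨ *-congˡ (trans (+-congˡ (trans (*-congˡ X≈0) (zeroʳ _))) (+-identityʳ _)) ⟩
        stirlingTerm k j
      ≈⟨ sym (+-identityʳ _) ⟩
        stirlingTerm k j + 0#
      ≈⟨ +-congˡ (sym (trans (*-congˡ (trans (*-congˡ X≈0) (zeroʳ _))) (zeroʳ _))) ⟩
        stirlingTerm k j + (t * q) * Q * stirlingTerm (suc k) j
      ∎
      where
        t = qint q 2
        Q = qint (q * q) (suc k)
        X = S (q * q) j (suc k)
        X≈0 : X ≈ 0#
        X≈0 = S-below (q * q) j (suc k) (s≤s (ℕ.≮⇒≥ k≮j))

    SB≈binomialTransform : ∀ n k → SB q n k ≈ binomialTransform (stirlingTerm k) n
    SB≈binomialTransform zero    zero    =
      sym (trans (binomialTransform-0 (stirlingTerm 0)) (trans (*-identityʳ _) (*-identityʳ _)))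
    SB≈binomialTransform zero    (suc k) = sym (trans (binomialTransform-0 (stirlingTerm (suc k))) (zeroʳ _))
    SB≈binomialTransform (suc n) zero    = sym (begin
        binomialTransform (stirlingTerm 0) (suc n)
      ≈⟨ binomialTransform-suc (stirlingTerm 0) n ⟩
        binomialTransform (stirlingTerm 0) n + binomialTransform (stirlingTerm 0 ∘ suc) n
      ≈⟨ +-cong (sym (SB≈binomialTransform n 0))
                (binomialTransform-zero (stirlingTerm 0 ∘ suc) (λ j → trans (*-congˡ (zeroˡ (S (q * q) j 0))) (zeroʳ _)) n) ⟩
        SB q n 0 + 0#
      ≈⟨ solve 2 (λ q s → s :+ con 0 := (con 1 :+ q :* con 0) :* s) refl q (SB q n 0) ⟩
        SB q (suc n) 0
      ∎)
    SB≈binomialTransform (suc n) (suc k) = sym (begin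
        binomialTransform (stirlingTerm (suc k)) (suc n)
      ≈⟨ binomialTransform-suc (stirlingTerm (suc k)) n ⟩
        binomialTransform (stirlingTerm (suc k)) n + binomialTransform (stirlingTerm (suc k) ∘ suc) n
      ≈⟨ +-congˡ (binomialTransform-cong (stirlingTerm-suc k) n) ⟩
        binomialTransform (stirlingTerm (suc k)) n + binomialTransform (λ j → stirlingTerm k j + P * stirlingTerm (suc k) j) n
      ≈⟨ +-congˡ (trans (binomialTransform-+ {stirlingTerm k} {λ j → P * stirlingTerm (suc k) j} n)
                        (+-congˡ (binomialTransform-* P (stirlingTerm (suc k)) n))) ⟩
        binomialTransform (stirlingTerm (suc k)) n
          + (binomialTransform (stirlingTerm k) n + P * binomialTransform (stirlingTerm (suc k)) n)
      ≈⟨ sym (+-cong (SB≈binomialTransform n (suc k))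
                     (+-cong (SB≈binomialTransform n k) (*-congˡ (SB≈binomialTransform n (suc k))))) ⟩
        SB q n (suc k) + (SB q n k + P * SB q n (suc k))
      ≈⟨ solve 5 (λ a b t q Q → a :+ (b :+ ((t :* q) :* Q) :* a) := b :+ (con 1 :+ q :* (t :* Q)) :* a) refl
           (SB q n (suc k)) (SB q n k) (qint q 2) q (qint (q * q) (suc k)) ⟩
        SB q n k + (1# + q * (qint q 2 * qint (q * q) (suc k))) * SB q n (suc k)
      ≈⟨ +-congˡ (*-congʳ (+-congˡ (*-congˡ (sym (qint-double (suc k)))))) ⟩
        SB q (suc n) (suc k)
      ∎)
      where
        P = (qint q 2 * q) * qint (q * q) (suc k)

    SB≈SBsum : ∀ n k → k ≤ n → SB q n k ≈ SBsum q n k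
    SB≈SBsum n k k≤n = begin
        SB q n k
      ≈⟨ SB≈binomialTransform n k ⟩
        binomialTransform (stirlingTerm k) n
      ≡⟨ ≡.cong (λ m → sumBelow m term) (≡.trans (ℕ.+-suc k (n ∸ k)) (≡.cong suc (ℕ.m+[n∸m]≡n k≤n))) ⟨
        sumBelow (k ℕ.+ suc (n ∸ k)) term
      ≈⟨ sumBelow-split k (suc (n ∸ k)) term ⟩
        sumBelow k term + ∑ℕ[ i < suc (n ∸ k) ] term (k ℕ.+ i)
      ≈⟨ +-congʳ (sumBelow-zero k (λ j j<k →
           trans (×-congʳ (n C j) (trans (*-congˡ (S-below (q * q) j k j<k)) (zeroʳ (qint q 2 ^ (j ∸ k) * q ^ (j ∸ k)))))
                 (×-zeroʳ (n C j)))) ⟩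
        0# + ∑ℕ[ i < suc (n ∸ k) ] term (k ℕ.+ i)
      ≈⟨ +-identityˡ _ ⟩
        ∑ℕ[ i < suc (n ∸ k) ] term (k ℕ.+ i)
      ≈⟨ sym (∑ₗ-applyUpTo term (k ℕ.+_) (suc (n ∸ k))) ⟩
        ∑ₗ term (List.applyUpTo (k ℕ.+_) (suc (n ∸ k)))
      ≡⟨ ≡.cong (∑ₗ term) (≡.sym (List.map-upTo (k ℕ.+_) (suc (n ∸ k)))) ⟩
        SBsum q n k
      ∎
      where
        term : ℕ → Carrier
        term j = (n C j) ·ℕ stirlingTerm k j

    module AllWords    = Paths (λ j → qint q (suc (2 ℕ.* j))) signedWeight
    module FullSupport = Paths (λ j → q * qint q (2 ℕ.* j)) signedWeight

    allWords≈DNorm*SB : ∀ n k → AllWords.paths n 0 k ≈ DNorm q k * SB q n k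
    allWords≈DNorm*SB = AllWords.paths-from-0 (λ n k → DNorm q k * SB q n k) init last₀ last
      where
        init : ∀ k → DNorm q k * SB q 0 k ≈ δ 0 k
        init zero    = trans (*-identityʳ _) (*-identityʳ _)
        init (suc k) = zeroʳ _

        last₀ : ∀ n → DNorm q 0 * SB q (suc n) 0 ≈ qint q 1 * (DNorm q 0 * SB q n 0)
        last₀ n = solve 3 (λ d N s → N :* (d :* s) := d :* (N :* s)) refl (qint q 1) (DNorm q 0) (SB q n 0)

        last : ∀ n k → DNorm q (suc k) * SB q (suc n) (suc k)
                       ≈ signedWeight k * (DNorm q k * SB q n k) + qint q (suc (2 ℕ.* suc k)) * (DNorm q (suc k) * SB q n (suc k))
        last n k = begin
            N′ * (SB q n k + d * SB q n (suc k))
          ≈⟨ solve 4 (λ N s d t → N :* (s :+ d :* t) := N :* s :+ d :* (N :* t)) refl N′ (SB q n k) d (SB q n (suc k)) ⟩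
            N′ * SB q n k + d * (N′ * SB q n (suc k))
          ≈⟨ +-congʳ (trans (*-congʳ (sym (signedWeight*DNorm k))) (*-assoc _ _ _)) ⟩
            signedWeight k * (DNorm q k * SB q n k) + d * (N′ * SB q n (suc k))
          ∎
          where
            N′ = DNorm q (suc k)
            d  = qint q (suc (2 ℕ.* suc k))

    fullSupport≈DNorm*stirlingTerm : ∀ n k → FullSupport.paths n 0 k ≈ DNorm q k * stirlingTerm k n
    fullSupport≈DNorm*stirlingTerm = FullSupport.paths-from-0 (λ n k → DNorm q k * stirlingTerm k n) init last₀ last
      where
        init : ∀ k → DNorm q k * stirlingTerm k 0 ≈ δ 0 k
        init zero    = solve 0 (con 1 :* con 1 :* (con 1 :* con 1 :* con 1) := con 1) refl
        init (suc k) = trans (*-congˡ (zeroʳ _)) (zeroʳ _)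

        last₀ : ∀ n → DNorm q 0 * stirlingTerm 0 (suc n) ≈ (q * 0#) * (DNorm q 0 * stirlingTerm 0 n)
        last₀ n = begin
            DNorm q 0 * (t * (0# * S (q * q) n 0))
          ≈⟨ *-congˡ (trans (*-congˡ (zeroˡ _)) (zeroʳ t)) ⟩
            DNorm q 0 * 0#
          ≈⟨ solve 3 (λ q N s → N :* con 0 := (q :* con 0) :* (N :* s)) refl q (DNorm q 0) (stirlingTerm 0 n) ⟩
            (q * 0#) * (DNorm q 0 * stirlingTerm 0 n)
          ∎
          where t = qint q 2 ^ suc n * q ^ suc n

        last : ∀ n k → DNorm q (suc k) * stirlingTerm (suc k) (suc n)
                       ≈ signedWeight k * (DNorm q k * stirlingTerm k n)
                         + (q * qint q (2 ℕ.* suc k)) * (DNorm q (suc k) * stirlingTerm (suc k) n)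
        last n k = begin
            N′ * stirlingTerm (suc k) (suc n)
          ≈⟨ *-congˡ (stirlingTerm-suc k n) ⟩
            N′ * (stirlingTerm k n + (t * q) * Q * stirlingTerm (suc k) n)
          ≈⟨ solve 6 (λ N s t q Q u → N :* (s :+ (t :* q) :* Q :* u) := N :* s :+ (q :* (t :* Q)) :* (N :* u)) refl
                   N′ (stirlingTerm k n) t q Q (stirlingTerm (suc k) n) ⟩
            N′ * stirlingTerm k n + (q * (t * Q)) * (N′ * stirlingTerm (suc k) n)
          ≈⟨ +-cong (trans (*-congʳ (sym (signedWeight*DNorm k))) (*-assoc _ _ _))
                    (*-congʳ (*-congˡ (sym (qint-double (suc k))))) ⟩
            signedWeight k * (DNorm q k * stirlingTerm k n) + (q * qint q (2 ℕ.* suc k)) * (N′ * stirlingTerm (suc k) n)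
          ∎
          where
            N′ = DNorm q (suc k)
            t  = qint q 2
            Q  = qint (q * q) (suc k)

    if-^-+ : ∀ B m n → (if B then q ^ (m ℕ.+ n) else 0#) ≈ q ^ m * (if B then q ^ n else 0#)
    if-^-+ true  m n = ^-homo-* q m n
    if-^-+ false m n = sym (zeroʳ _)

    module _ (k : ℕ) where

      ∑ₗ-entries : ∀ (g : Entry k → Carrier) →
                   ∑ₗ g (entries k) ≈ g nothing + sum (λ b → g (just (b , true)) + g (just (b , false)))
      ∑ₗ-entries g = +-congˡ (trans (pairs (List.allFin k)) (∑ₗ-tabulate {n = k} both (λ b → b)))
        where
          both : Fin k → Carrier
          both b = g (just (b , true)) + g (just (b , false))

          pairs : ∀ bs → ∑ₗ g (List.map just (List.cartesianProduct bs (true ∷ false ∷ []))) ≈ ∑ₗ both bs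
          pairs []       = refl
          pairs (b ∷ bs) = trans (sym (+-assoc _ _ _)) (+-congˡ (pairs bs))

      ∑ₗ-allAssign : ∀ n (f : Assign (suc n) k → Carrier) →
                     ∑ₗ f (allAssign (suc n) k) ≈ ∑ₗ (λ e → ∑ₗ (λ a → f (e ∷ a)) (allAssign n k)) (entries k)
      ∑ₗ-allAssign n f = trans (∑ₗ-concatMap f (λ e → List.map (e ∷_) (allAssign n k)) (entries k))
                               (∑ₗ-cong (entries k) (λ e → ∑ₗ-map f (e ∷_) (allAssign n k)))

      gf : ∀ {n} → (Assign n k → Bool) → ℕ → Carrier
      gf {n} Q j = ∑ₗ (λ a → if restrictedGrowth j a ∧ Q a then q ^ weight a else 0#) (allAssign n k)

      headInBlock : (ℕ → Carrier) → ℕ → Carrier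
      headInBlock Z j = ∑ℕ[ i < k ] (signedWeight i * stayClimb (Z j) (Z (suc j)) 0# j i)

      gf-offset : ∀ {n} (Q : Assign n k → Bool) m j →
        ∑ₗ (λ a → if restrictedGrowth j a ∧ Q a then q ^ (m ℕ.+ weight a) else 0#) (allAssign n k) ≈ q ^ m * gf Q j
      gf-offset {n} Q m j = trans (∑ₗ-cong (allAssign n k) (λ a → if-^-+ (restrictedGrowth j a ∧ Q a) m (weight a)))
                                  (sym (*-distribˡ-∑ₗ _ _ (allAssign n k)))

      gf-head : ∀ {n} (Q : Assign n k → Bool) j (b : Fin k) s →
        ∑ₗ (λ a → if restrictedGrowth j (just (b , s) ∷ a) ∧ Q a then q ^ weight (just (b , s) ∷ a) else 0#)
           (allAssign n k)
          ≈ q ^ entryWeight (just (b , s)) * stayClimb (gf Q j) (gf Q (suc j)) 0# j (toℕ b)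
      gf-head {n} Q j b s with toℕ b <ᵇ j | toℕ b ≡ᵇ j
      ... | true  | _     = gf-offset Q (entryWeight (just (b , s))) j
      ... | false | true  = gf-offset Q (entryWeight (just (b , s))) (suc j)
      ... | false | false = trans (∑ₗ-zero (allAssign n k) (λ _ → refl)) (sym (zeroʳ _))

      if-∧-cong : ∀ B {b b′ : Bool} x → b ≡ b′ → (if B ∧ b then x else 0#) ≈ (if B ∧ b′ then x else 0#)
      if-∧-cong B x b≡b′ = reflexive (≡.cong (λ t → if B ∧ t then x else 0#) b≡b′)

      gf-∷ : ∀ {n} (Q′ : Assign (suc n) k → Bool) (Qn Qj : Assign n k → Bool) →
             (∀ a → Q′ (nothing ∷ a) ≡ Qn a) → (∀ b s a → Q′ (just (b , s) ∷ a) ≡ Qj a) →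
             ∀ j → gf Q′ j ≈ gf Qn j + headInBlock (gf Qj) j
      gf-∷ {n} Q′ Qn Qj Q′-nothing Q′-just j = begin
          gf Q′ j
        ≈⟨ ∑ₗ-allAssign n f ⟩
          ∑ₗ (λ e → ∑ₗ (λ a → f (e ∷ a)) (allAssign n k)) (entries k)
        ≈⟨ ∑ₗ-entries (λ e → ∑ₗ (λ a → f (e ∷ a)) (allAssign n k)) ⟩
          ∑ₗ (λ a → f (nothing ∷ a)) (allAssign n k) + sum (λ b → headTerm b true + headTerm b false)
        ≈⟨ +-cong (∑ₗ-cong (allAssign n k) (λ a → if-∧-cong (restrictedGrowth j a) (q ^ weight a) (Q′-nothing a)))
                  (sum-cong-≋ {k} block) ⟩
          gf Qn j + headInBlock (gf Qj) j
        ∎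
        where
          f : Assign (suc n) k → Carrier
          f a = if restrictedGrowth j a ∧ Q′ a then q ^ weight a else 0#

          headTerm : Fin k → Bool → Carrier
          headTerm b s = ∑ₗ (λ a → f (just (b , s) ∷ a)) (allAssign n k)

          next : ℕ → Carrier
          next i = stayClimb (gf Qj j) (gf Qj (suc j)) 0# j i

          headTerm≈ : ∀ b s → headTerm b s ≈ q ^ entryWeight (just (b , s)) * next (toℕ b)
          headTerm≈ b s = trans (∑ₗ-cong (allAssign n k) (λ a → if-∧-cong (restrictedGrowth j (just (b , s) ∷ a))
                                                                           (q ^ weight (just (b , s) ∷ a)) (Q′-just b s a)))
                                (gf-head Qj j b s)

          block : ∀ b → headTerm b true + headTerm b false ≈ signedWeight (toℕ b) * next (toℕ b)
          block b = trans (+-cong (headTerm≈ b true) (headTerm≈ b false)) (sym (distribʳ _ _ _))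

      gf-above : ∀ {n} (Q : Assign n k → Bool) j → k < j → gf Q j ≈ 0#
      gf-above {n} Q j k<j = ∑ₗ-zero (allAssign n k) (λ a →
        reflexive (≡.cong (λ t → if t ∧ Q a then q ^ weight a else 0#) (restrictedGrowth-above j a k<j)))

      headInBlock-cong : ∀ {Z Z′ : ℕ → Carrier} → (∀ j → Z j ≈ Z′ j) → ∀ j → headInBlock Z j ≈ headInBlock Z′ j
      headInBlock-cong {Z} Z≈Z′ j = sumBelow-cong k {λ i → signedWeight i * stayClimb (Z j) (Z (suc j)) 0# j i}
                                      (λ i → *-congˡ (stayClimb-cong j i (Z≈Z′ j) (Z≈Z′ (suc j))))

      headInBlock-≤ : ∀ (Z : ℕ → Carrier) → Z (suc k) ≈ 0# → ∀ j → j ≤ k →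
                      headInBlock Z j ≈ q * qint q (2 ℕ.* j) * Z j + signedWeight j * Z (suc j)
      headInBlock-≤ Z Z-above j j≤k with ℕ.m≤n⇒m<n∨m≡n j≤k
      ... | inj₁ j<k = trans (sum-stayClimb signedWeight (Z j) (Z (suc j)) j k j<k)
                             (+-congʳ (*-congʳ (sum-signedWeight j)))
      ... | inj₂ ≡.refl = begin
          headInBlock Z k
        ≈⟨ sum-stayClimb-top signedWeight (Z k) (Z (suc k)) k ⟩
          ∑ℕ[ i < k ] signedWeight i * Z k
        ≈⟨ *-congʳ (sum-signedWeight k) ⟩
          q * qint q (2 ℕ.* k) * Z k
        ≈⟨ sym (trans (+-congˡ (trans (*-congˡ Z-above) (zeroʳ _))) (+-identityʳ _)) ⟩
          q * qint q (2 ℕ.* k) * Z k + signedWeight k * Z (suc k)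
        ∎

      headInBlock-zero : ∀ {Z : ℕ → Carrier} → (∀ j → Z j ≈ 0#) → ∀ j → headInBlock Z j ≈ 0#
      headInBlock-zero Z≈0 j =
        sumBelow-zero k (λ i _ → trans (*-congˡ (stayClimb-zero j i (Z≈0 j) (Z≈0 (suc j)))) (zeroʳ (signedWeight i)))

      gf-step : ∀ {n} (Q′ : Assign (suc n) k → Bool) (Qn Qj : Assign n k → Bool) →
                (∀ a → Q′ (nothing ∷ a) ≡ Qn a) → (∀ b s a → Q′ (just (b , s) ∷ a) ≡ Qj a) → ∀ j → j ≤ k →
                gf Q′ j ≈ gf Qn j + (q * qint q (2 ℕ.* j) * gf Qj j + signedWeight j * gf Qj (suc j))
      gf-step Q′ Qn Qj Q′-nothing Q′-just j j≤k =
        trans (gf-∷ Q′ Qn Qj Q′-nothing Q′-just j)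
              (+-congˡ (headInBlock-≤ (gf Qj) (gf-above Qj (suc k) (ℕ.n<1+n k)) j j≤k))

      gf≈paths : (stay : ℕ → Carrier) (Q : ∀ {n} → Assign n k → Bool) → Q [] ≡ true →
                 (∀ n j → j ≤ k → gf (Q {suc n}) j ≈ stay j * gf (Q {n}) j + signedWeight j * gf (Q {n}) (suc j)) →
                 ∀ n j → gf (Q {n}) j ≈ Paths.paths stay signedWeight n j k
      gf≈paths stay Q Q[] Q-step = go
        where
          go : ∀ n j → gf (Q {n}) j ≈ Paths.paths stay signedWeight n j k
          go zero    j = trans (+-identityʳ _)
            (reflexive (≡.cong (if_then 1# else 0#) (≡.trans (≡.cong ((j ≡ᵇ k) ∧_) Q[]) (∧-identityʳ _))))
          go (suc n) j with j ℕ.≤? k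
          ... | yes j≤k = trans (Q-step n j j≤k) (+-cong (*-congˡ (go n j)) (*-congˡ (go n (suc j))))
          ... | no  j≰k = trans (gf-above (Q {suc n}) j k<j) (sym (Paths.paths-below stay signedWeight (suc n) j k k<j))
            where k<j = ℕ.≰⇒> j≰k

      gf-all≈paths : ∀ n j → gf {n} (λ _ → true) j ≈ AllWords.paths n j k
      gf-all≈paths = gf≈paths _ (λ _ → true) ≡.refl (λ n j j≤k →
        trans (gf-step {n} (λ _ → true) (λ _ → true) (λ _ → true) (λ _ → ≡.refl) (λ _ _ _ → ≡.refl) j j≤k)
              (solve 4 (λ x a c y → x :+ (a :* x :+ c :* y) := (con 1 :+ a) :* x :+ c :* y) refl
                     (gf {n} (λ _ → true) j) (q * qint q (2 ℕ.* j)) (signedWeight j) (gf {n} (λ _ → true) (suc j))))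

      fullSupport : ∀ {n} → Assign n k → Bool
      fullSupport = Vec.foldr (λ _ → Bool) (λ e r → not (isNothing e) ∧ r) true

      gf-none : ∀ {n} j → gf {n} (λ _ → false) j ≈ 0#
      gf-none {n} j = ∑ₗ-zero (allAssign n k) (λ a →
        reflexive (≡.cong (if_then q ^ weight a else 0#) (∧-zeroʳ (restrictedGrowth j a))))

      gf-fullSupport≈paths : ∀ n j → gf {n} fullSupport j ≈ FullSupport.paths n j k
      gf-fullSupport≈paths = gf≈paths _ fullSupport ≡.refl (λ n j j≤k →
        trans (gf-step {n} fullSupport (λ _ → false) fullSupport (λ _ → ≡.refl) (λ _ _ _ → ≡.refl) j j≤k)
              (trans (+-congʳ (gf-none {n} j)) (+-identityˡ _)))

      gf-allBut≈gf-fullSupport : ∀ n (i : Fin (suc n)) j → gf {suc n} (supportIsAllBut i) j ≈ gf {n} fullSupport j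
      gf-allBut≈gf-fullSupport n Fin.zero j = begin
          gf (supportIsAllBut {suc n} Fin.zero) j
        ≈⟨ gf-∷ (supportIsAllBut Fin.zero) (fullSupport {n}) (λ _ → false) (λ _ → ≡.refl) (λ _ _ _ → ≡.refl) j ⟩
          gf {n} fullSupport j + headInBlock (gf {n} (λ _ → false)) j
        ≈⟨ +-congˡ (headInBlock-zero (gf-none {n}) j) ⟩
          gf {n} fullSupport j + 0#
        ≈⟨ +-identityʳ _ ⟩
          gf {n} fullSupport j
        ∎
      gf-allBut≈gf-fullSupport (suc n) (Fin.suc i) j = begin
          gf (supportIsAllBut (Fin.suc i)) j
        ≈⟨ gf-∷ (supportIsAllBut (Fin.suc i)) (λ _ → false) (supportIsAllBut i) (λ _ → ≡.refl) (λ _ _ _ → ≡.refl) j ⟩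
          gf {suc n} (λ _ → false) j + headInBlock (gf (supportIsAllBut i)) j
        ≈⟨ +-cong (gf-none {suc n} j) (headInBlock-cong (gf-allBut≈gf-fullSupport n i) j) ⟩
          0# + headInBlock (gf {n} fullSupport) j
        ≈⟨ +-identityˡ _ ⟩
          headInBlock (gf {n} fullSupport) j
        ≈⟨ sym (trans (gf-∷ (fullSupport {suc n}) (λ _ → false) fullSupport (λ _ → ≡.refl) (λ _ _ _ → ≡.refl) j)
                      (trans (+-congʳ (gf-none {n} j)) (+-identityˡ _))) ⟩
          gf {suc n} fullSupport j
        ∎

      weightIfPSSP : ∀ {n} → (Assign n k → Bool) → Assign n k → Carrier
      weightIfPSSP Q a = if isPSSP a ∧ Q a then q ^ mStat a else 0#

      ∑ₗ-PSSP≈gf : ∀ {n} (Q : Assign n k → Bool) → ∑ₗ (weightIfPSSP Q) (allAssign n k) ≈ gf Q 0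
      ∑ₗ-PSSP≈gf {n} Q = ∑ₗ-cong (allAssign n k) (λ a →
        reflexive (≡.cong₂ (λ t m → if t ∧ Q a then q ^ m else 0#) (isPSSP≡restrictedGrowth a) (mStat≡weight a)))

      -- No support misses two different points, so at most one summand is nonzero.
      sum-supportIsAllBut : ∀ {n} (a : Assign n k) x →
        ∑ₗ (λ i → if supportIsAllBut i a then x else 0#) (List.allFin n) ≈ (if inSomeAllBut a then x else 0#)
      sum-supportIsAllBut {n} a x = begin
          ∑ₗ (λ i → if supportIsAllBut i a then x else 0#) (List.allFin n)
        ≈⟨ ∑ₗ-tabulate {n = n} (λ i → if supportIsAllBut i a then x else 0#) (λ i → i) ⟩
          sum (λ i → if supportIsAllBut i a then x else 0#)
        ≈⟨ sum≈any a ⟩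
          (if List.foldr _∨_ false (List.tabulate (λ i → supportIsAllBut i a)) then x else 0#)
        ≡⟨ ≡.cong (λ b → if List.foldr _∨_ false b then x else 0#)
                  (List.map-tabulate (λ i → i) (λ i → supportIsAllBut i a)) ⟨
          (if inSomeAllBut a then x else 0#)
        ∎
        where
          none : ∀ m → List.foldr _∨_ false (List.tabulate {n = m} (λ _ → false)) ≡ false
          none zero    = ≡.refl
          none (suc m) = none m

          sum≈any : ∀ {n} (a : Assign n k) →
            sum (λ i → if supportIsAllBut i a then x else 0#)
              ≈ (if List.foldr _∨_ false (List.tabulate (λ i → supportIsAllBut i a)) then x else 0#)
          sum≈any []                  = refl
          sum≈any {suc n} (nothing ∷ a) = begin
              (if fullSupport a then x else 0#) + sum {n} (λ _ → 0#)
            ≈⟨ +-congˡ (sum-replicate-zero n) ⟩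
              (if fullSupport a then x else 0#) + 0#
            ≈⟨ +-identityʳ _ ⟩
              (if fullSupport a then x else 0#)
            ≡⟨ ≡.cong (λ b → if b then x else 0#) (≡.trans (≡.cong (fullSupport a ∨_) (none n)) (∨-identityʳ _)) ⟨
              (if fullSupport a ∨ List.foldr _∨_ false (List.tabulate {n = n} (λ _ → false)) then x else 0#)
            ∎
          sum≈any (just _ ∷ a) = trans (+-identityˡ _) (sum≈any a)

      PSSP-split : ∀ {n} (a : Assign n k) →
        weightIfPSSP (λ _ → true) a
          ≈ (if isD a then q ^ mStat a else 0#)
            + ∑ₗ (λ i → weightIfPSSP (supportIsAllBut i) a) (List.allFin n)
      PSSP-split {n} a = begin
          (if isPSSP a ∧ true then w else 0#)
        ≈⟨ split (isPSSP a) (inSomeAllBut a) ⟩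
          (if isD a then w else 0#) + (if inSomeAllBut a then (if isPSSP a then w else 0#) else 0#)
        ≈⟨ +-congˡ (sym (sum-supportIsAllBut a _)) ⟩
          (if isD a then w else 0#) + ∑ₗ (λ i → if supportIsAllBut i a then (if isPSSP a then w else 0#) else 0#) (List.allFin n)
        ≈⟨ +-congˡ (∑ₗ-cong (List.allFin n) (λ i → reflexive (∧-if (isPSSP a) (supportIsAllBut i a)))) ⟨
          (if isD a then w else 0#) + ∑ₗ (λ i → if isPSSP a ∧ supportIsAllBut i a then w else 0#) (List.allFin n)
        ∎
        where
          w = q ^ mStat a
          split : ∀ P S → (if P ∧ true then w else 0#)
                          ≈ (if P ∧ not S then w else 0#) + (if S then (if P then w else 0#) else 0#)
          split true  true  = sym (+-identityˡ w)
          split true  false = sym (+-identityʳ w)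
          split false true  = sym (+-identityˡ 0#)
          split false false = sym (+-identityˡ 0#)
          ∧-if : ∀ P S → (if P ∧ S then w else 0#) ≡ (if S then (if P then w else 0#) else 0#)
          ∧-if true  S     = ≡.refl
          ∧-if false true  = ≡.refl
          ∧-if false false = ≡.refl

      allButOneSum : ℕ → Carrier
      allButOneSum n = ∑ₗ (λ i → ∑ₗ (weightIfPSSP (supportIsAllBut i)) (allAssign n k)) (List.allFin n)

      DNorm*SB≈DSum+allButOneSum : ∀ n → DNorm q k * SB q n k ≈ DSum q n k + allButOneSum n
      DNorm*SB≈DSum+allButOneSum n = begin
          DNorm q k * SB q n k
        ≈⟨ allWords≈DNorm*SB n k ⟨
          AllWords.paths n 0 k
        ≈⟨ gf-all≈paths n 0 ⟨
          gf {n} (λ _ → true) 0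
        ≈⟨ ∑ₗ-PSSP≈gf {n} (λ _ → true) ⟨
          ∑ₗ (weightIfPSSP (λ _ → true)) (allAssign n k)
        ≈⟨ ∑ₗ-cong (allAssign n k) PSSP-split ⟩
          ∑ₗ (λ a → (if isD a then q ^ mStat a else 0#) + missing a) (allAssign n k)
        ≈⟨ ∑ₗ-distrib-+ _ missing (allAssign n k) ⟩
          ∑ₗ (λ a → if isD a then q ^ mStat a else 0#) (allAssign n k) + ∑ₗ missing (allAssign n k)
        ≈⟨ +-cong (sym (∑ₗ-filter isD (λ a → q ^ mStat a) (allAssign n k)))
                  (∑ₗ-comm (λ a i → weightIfPSSP (supportIsAllBut i) a) (allAssign n k) (List.allFin n)) ⟩
          DSum q n k + allButOneSum n
        ∎
        where
          missing : Assign n k → Carrier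
          missing a = ∑ₗ (λ i → weightIfPSSP (supportIsAllBut i) a) (List.allFin n)

      allButOneSum≈DNorm*SDcorr : ∀ n → allButOneSum n ≈ DNorm q k * SDcorr q n k
      allButOneSum≈DNorm*SDcorr zero    = sym (zeroʳ _)
      allButOneSum≈DNorm*SDcorr (suc n) = begin
          allButOneSum (suc n)
        ≈⟨ ∑ₗ-tabulate {n = suc n} (λ i → ∑ₗ (weightIfPSSP (supportIsAllBut i)) (allAssign (suc n) k)) (λ i → i) ⟩
          sum (λ i → ∑ₗ (weightIfPSSP (supportIsAllBut i)) (allAssign (suc n) k))
        ≈⟨ sum-cong-≋ {suc n} missing-i ⟩
          sum {suc n} (λ _ → DNorm q k * stirlingTerm k n)
        ≈⟨ sum-replicate (suc n) ⟩
          suc n ·ℕ (DNorm q k * stirlingTerm k n)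
        ≈⟨ ×-comm-* (suc n) (DNorm q k) (stirlingTerm k n) ⟨
          DNorm q k * (suc n ·ℕ stirlingTerm k n)
        ≡⟨ ≡.cong (λ e → DNorm q k * (suc n ·ℕ (qint q 2 ^ e * q ^ e * S (q * q) n k)))
                  (≡.trans (ℕ.∸-+-assoc (suc n) k 1) (≡.cong (suc n ∸_) (ℕ.+-comm k 1))) ⟨
          DNorm q k * SDcorr q (suc n) k
        ∎
        where
          missing-i : ∀ i → ∑ₗ (weightIfPSSP (supportIsAllBut i)) (allAssign (suc n) k)
                            ≈ DNorm q k * stirlingTerm k n
          missing-i i = begin
              ∑ₗ (weightIfPSSP (supportIsAllBut i)) (allAssign (suc n) k)
            ≈⟨ ∑ₗ-PSSP≈gf (supportIsAllBut i) ⟩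
              gf (supportIsAllBut i) 0
            ≈⟨ gf-allBut≈gf-fullSupport n i 0 ⟩
              gf {n} fullSupport 0
            ≈⟨ gf-fullSupport≈paths n 0 ⟩
              FullSupport.paths n 0 k
            ≈⟨ fullSupport≈DNorm*stirlingTerm n k ⟩
              DNorm q k * stirlingTerm k n
            ∎

      DNorm*SB≈DSum+DNorm*SDcorr : ∀ n → DNorm q k * SB q n k ≈ DSum q n k + DNorm q k * SDcorr q n k
      DNorm*SB≈DSum+DNorm*SDcorr n = trans (DNorm*SB≈DSum+allButOneSum n) (+-congˡ (allButOneSum≈DNorm*SDcorr n))

proposition3p6 : ∀ {c ℓ : Level} (R : CommutativeRing c ℓ) (q : CommutativeRing.Carrier R) (n k : ℕ) → k ≤ n →
    let open CommutativeRing R in let open QStirling R in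
      (SB q n k ≈ SBsum q n k) ×
      (DNorm q k * SB q n k ≈ DSum q n k + DNorm q k * SDcorr q n k)
proposition3p6 R q n k k≤n = SB≈SBsum R q n k k≤n , DNorm*SB≈DSum+DNorm*SDcorr R q k n
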